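{- For $n\geq 1$, the number of permutations $\pi\in\mathcal{S}_n$ with at most one descent such that $\operatorname{des}(\pi^2)\leq 3$ equals $2^n-n$.
   Context: $\mathcal{S}_n$ is the symmetric group on $[n]$; a permutation $\pi=\pi_1\cdots\pi_n$ (one-line notation) has a descent at $i\in[n-1]$ if $\pi_i>\pi_{i+1}$, and $\operatorname{des}(\pi)$ is the number of descents. $\pi^2(i)=\pi(\pi(i))$. -}

module Defs where

open import Data.Nat using (ℕ; zero; suc; _≤_; _≤?_; _<ᵇ_)
open import Data.Fin using (Fin; toℕ)
open import Data.Fin.Properties using (_≟_)
open import Data.Vec using (Vec; []; _∷_; lookup; tabulate; toList)
open import Data.List using (List; []; _∷_; length; filter; map; concatMap; allFin; sum)
open import Data.Bool using (Bool; true; false; if_then_else_)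
open import Data.Product using (_×_)
open import Relation.Nullary using (Dec; ¬_)
open import Relation.Nullary.Decidable using (_×-dec_)
open import Relation.Binary.PropositionalEquality using (_≡_)
open import Data.List.Relation.Unary.All as All using (All)
open import Relation.Nullary.Decidable using (_→-dec_)
open import Data.Fin.Properties using (all?)

-- A permutation of [n] in one-line notation: a word π₁⋯πₙ over Fin n
-- (0-indexed values) such that i ↦ π_i is injective (hence bijective on Fin n).
IsPerm : ∀ {n} → Vec (Fin n) n → Set
IsPerm v = ∀ i j → lookup v i ≡ lookup v j → i ≡ j

isPerm? : ∀ {n} (v : Vec (Fin n) n) → Dec (IsPerm v)
isPerm? v = all? (λ i → all? (λ j → (lookup v i ≟ lookup v j) →-dec (i ≟ j)))

words : (n k : ℕ) → List (Vec (Fin n) k)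
words n zero = [] ∷ []
words n (suc k) = concatMap (λ i → map (i ∷_) (words n k)) (allFin n)

desW : ∀ {n k} → Vec (Fin n) k → ℕ
desW [] = 0
desW (x ∷ []) = 0
desW (x ∷ y ∷ w) = (if toℕ y <ᵇ toℕ x then 1 else 0) Data.Nat.+ desW (y ∷ w)

square : ∀ {n} → Vec (Fin n) n → Vec (Fin n) n
square v = tabulate (λ i → lookup v (lookup v i))

Good : ∀ {n} → Vec (Fin n) n → Set
Good v = IsPerm v × (desW v ≤ 1 × desW (square v) ≤ 3)

good? : ∀ {n} (v : Vec (Fin n) n) → Dec (Good v)
good? v = isPerm? v ×-dec ((desW v ≤? 1) ×-dec (desW (square v) ≤? 3))

countGood : ℕ → ℕ
countGood n = length (filter good? (words n n))

-- A permutation with at most one descent (a Grassmannian permutation) is determined by the set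
-- U of values in its first ascending run: it lists U increasingly and then the complement of U
-- increasingly.  Conversely, listing the ones of a bit vector b and then its zeros gives such a
-- permutation, whose first run is exactly the ones of b unless b = 1ʲ0ᵏ⁻ʲ with j < k.  Hence
-- these permutations correspond to the 2ⁿ − n remaining ("admissible") bit vectors.  The
-- condition des π² ≤ 3 comes for free: π² is π applied to its two increasing runs, each image
-- is a subsequence of π and so has at most one descent, and the concatenation adds at most one
-- more.

module Submission where

open import Defs
open import Data.Nat using (ℕ; _≤_; _∸_; _^_)
open import Relation.Binary.PropositionalEquality using (_≡_)

open import Level using (Level)
open import Function using (_∘_; _⇔_; mk⇔)
open import Data.Bool using (Bool; true; false; if_then_else_; T)
open import Data.Bool.Properties using (T?)
open import Data.Unit using (tt)
open import Data.Sum using (_⊎_; inj₁; inj₂)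
open import Data.Product using (_×_; _,_; proj₁; proj₂; ∃; ∃₂)
open import Data.Nat using (zero; suc; _+_; z≤n; s≤s; s≤s⁻¹; _<ᵇ_; _<?_)
open import Data.Nat.Properties
  using ( <ᵇ-reflects-<; ≤-refl; ≤-trans; ≤-reflexive; m≤m+n; m≤n+m; n≤1+n; n<1+n; +-assoc
        ; +-monoˡ-≤; +-monoʳ-≤; +-mono-≤; m+n≡0⇒m≡0; m+n≡0⇒n≡0; n≤0⇒n≡0; <⇒≤; <⇒≱; ≮⇒≥
        ; <-≤-trans; ≤-<-trans; ≤∧≢⇒<; m+n∸m≡n; +-identityʳ; +-commutativeSemigroup; module ≤-Reasoning)
  renaming (_≟_ to _≟ℕ_)
open import Algebra.Properties.CommutativeSemigroup +-commutativeSemigroup using (x∙yz≈y∙xz)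
open import Data.Fin as F using (Fin; toℕ; punchOut)
open import Data.Fin.Properties as FP using (toℕ-injective; any?; pigeonhole; punchOut-injective)
open import Data.Vec as V using (Vec; toList; lookup; tabulate)
import Data.Vec.Properties as VP
open import Data.Vec.Membership.Propositional.Properties using (∈-lookup; ∈-toList⁺)
open import Data.List as L using (List; []; _∷_; _++_; length; filter; map; allFin; concatMap; cartesianProductWith)
import Data.List.Properties as LP
open import Data.List.Membership.Propositional using (_∈_; _∉_)
open import Data.List.Membership.Propositional.Properties
  using (∈-++⁺ˡ; ∈-++⁺ʳ; ∈-++⁻; ∈-map⁺; ∈-map⁻; ∈-filter⁺; ∈-filter⁻; ∈-allFin; ∈-cartesianProductWith⁺)
open import Data.List.Membership.Propositional.Properties.WithK using (unique∧set⇒bag)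
open import Data.List.Relation.Unary.Any as Any using (Any; here; there)
import Data.List.Relation.Unary.All as All
import Data.List.Relation.Unary.All.Properties as All
open import Data.List.Relation.Unary.AllPairs as AllPairs using (AllPairs; []; _∷_)
import Data.List.Relation.Unary.AllPairs.Properties as AllPairs
open import Data.List.Relation.Unary.Linked using (Linked; []; [-]; _∷_)
open import Data.List.Relation.Unary.Linked.Properties using (Linked⇒AllPairs)
open import Data.List.Relation.Unary.Unique.Propositional using (Unique)
import Data.List.Relation.Unary.Unique.Propositional.Properties as Unique
open import Data.List.Relation.Binary.Disjoint.Propositional using (Disjoint)
open import Data.List.Relation.Binary.Sublist.Propositional using (_⊆_; []; _∷_; _∷ʳ_; minimum; ⊆-antisym)
import Data.List.Relation.Binary.Sublist.Propositional.Properties as Sublist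
open import Data.List.Relation.Binary.BagAndSetEquality using (∼bag⇒↭)
open import Data.List.Relation.Binary.Permutation.Propositional.Properties using (↭-length)
open import Relation.Nullary using (Dec; yes; no; does; contradiction)
open import Relation.Nullary.Reflects using (ofʸ; ofⁿ)
open import Relation.Unary using (Pred; Decidable)
open import Relation.Binary.Core using (Rel)
open import Relation.Binary.Structures using (IsStrictPartialOrder)
open import Relation.Binary.PropositionalEquality using (refl; sym; trans; cong; cong₂; subst; _≢_; module ≡-Reasoning)

private variable a b p q ℓ : Level

Unique-++⁻ : ∀ {A : Set a} (xs : List A) {ys} → Unique (xs ++ ys) → Unique xs × Unique ys × Disjoint xs ys
Unique-++⁻ []       u-ys = [] , u-ys , λ ()
Unique-++⁻ (x ∷ xs) (x∉ ∷ u) with Unique-++⁻ xs u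
... | u-xs , u-ys , xs#ys = All.++⁻ˡ xs x∉ ∷ u-xs , u-ys , λ where
  (here refl   , x∈ys) → All.lookup x∉ (∈-++⁺ʳ xs x∈ys) refl
  (there z∈xs , z∈ys) → xs#ys (z∈xs , z∈ys)

Unique-⇔⇒length-≡ : ∀ {A : Set a} {xs ys : List A} → Unique xs → Unique ys →
                     (∀ {z} → z ∈ xs ⇔ z ∈ ys) → length xs ≡ length ys
Unique-⇔⇒length-≡ u-xs u-ys xs⇔ys = ↭-length (∼bag⇒↭ (unique∧set⇒bag u-xs u-ys xs⇔ys))

length-filter-map : ∀ {A : Set a} {B : Set b} {P : Pred B p} (P? : Decidable P) (f : A → B) xs →
                    length (filter P? (map f xs)) ≡ length (filter (P? ∘ f) xs)
length-filter-map P? f []       = refl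
length-filter-map P? f (x ∷ xs) with does (P? (f x))
... | true  = cong suc (length-filter-map P? f xs)
... | false = length-filter-map P? f xs

module _ {A : Set a} {B : Set b} {P : Pred A p} {Q : Pred B q}
         (P? : Decidable P) (Q? : Decidable Q) (f : A → B) (g : B → A) where

  length-filter-≡-by-inverses :
    ∀ {xs ys} → Unique xs → (∀ x → x ∈ xs) → Unique ys → (∀ y → y ∈ ys) →
    (∀ {x} → P x → Q (f x)) → (∀ {y} → Q y → P (g y)) →
    (∀ {x} → P x → g (f x) ≡ x) → (∀ {y} → Q y → f (g y) ≡ y) →
    length (filter P? xs) ≡ length (filter Q? ys)
  length-filter-≡-by-inverses {xs} {ys} u-xs all-xs u-ys all-ys fP gQ gf fg = begin
    length Ps           ≡⟨ LP.length-map f Ps ⟨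
    length (map f Ps)   ≡⟨ Unique-⇔⇒length-≡ u-fPs (Unique.filter⁺ Q? u-ys) (mk⇔ to from) ⟩
    length (filter Q? ys) ∎
    where
    open ≡-Reasoning
    Ps = filter P? xs
    gfPs≡Ps : map g (map f Ps) ≡ Ps
    gfPs≡Ps = trans (sym (LP.map-∘ Ps)) (LP.map-id-local (All.map gf (All.all-filter P? xs)))
    u-fPs : Unique (map f Ps)
    u-fPs = Unique.map⁻ (subst Unique (sym gfPs≡Ps) (Unique.filter⁺ P? u-xs))
    to : ∀ {y} → y ∈ map f Ps → y ∈ filter Q? ys
    to y∈ with ∈-map⁻ f y∈
    ... | x , x∈Ps , refl = ∈-filter⁺ Q? (all-ys (f x)) (fP (proj₂ (∈-filter⁻ P? {xs = xs} x∈Ps)))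
    from : ∀ {y} → y ∈ filter Q? ys → y ∈ map f Ps
    from {y} y∈ = subst (_∈ map f Ps) (fg Qy) (∈-map⁺ f (∈-filter⁺ P? (all-xs (g y)) (gQ Qy)))
      where Qy = proj₂ (∈-filter⁻ Q? {xs = ys} y∈)

module StrictlySorted {A : Set a} {_<_ : Rel A ℓ} (<-isStrictPartialOrder : IsStrictPartialOrder _≡_ _<_) where

  open IsStrictPartialOrder <-isStrictPartialOrder using (irrefl) renaming (trans to <-trans)

  ∈-tail : ∀ {y z ys} → y < z → z ∈ y ∷ ys → z ∈ ys
  ∈-tail y<z (here z≡y)  = contradiction y<z (irrefl (sym z≡y))
  ∈-tail _   (there z∈ys) = z∈ys

  sorted-⊆ : ∀ {xs ys} → AllPairs _<_ xs → AllPairs _<_ ys → (∀ {z} → z ∈ xs → z ∈ ys) → xs ⊆ ys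
  sorted-⊆ {[]}     _ _ _ = minimum _
  sorted-⊆ {x ∷ xs} {[]} _ _ xs⊆ys with () ← xs⊆ys (here refl)
  sorted-⊆ {x ∷ xs} {y ∷ ys} (x<xs ∷ xs↗) (y<ys ∷ ys↗) xs⊆ys with xs⊆ys (here refl)
  ... | here refl  = refl ∷ sorted-⊆ xs↗ ys↗ λ z∈xs → ∈-tail (All.lookup x<xs z∈xs) (xs⊆ys (there z∈xs))
  ... | there x∈ys = y ∷ʳ sorted-⊆ (x<xs ∷ xs↗) ys↗ λ z∈ → ∈-tail (y<z z∈) (xs⊆ys z∈)
    where
    y<z : ∀ {z} → z ∈ x ∷ xs → y < z
    y<z (here refl)   = All.lookup y<ys x∈ys
    y<z (there z∈xs) = <-trans (All.lookup y<ys x∈ys) (All.lookup x<xs z∈xs)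

  sorted-≡ : ∀ {xs ys} → AllPairs _<_ xs → AllPairs _<_ ys →
             (∀ {z} → z ∈ xs → z ∈ ys) → (∀ {z} → z ∈ ys → z ∈ xs) → xs ≡ ys
  sorted-≡ xs↗ ys↗ xs⊆ys ys⊆xs = ⊆-antisym (sorted-⊆ xs↗ ys↗ xs⊆ys) (sorted-⊆ ys↗ xs↗ ys⊆xs)

module _ {A : Set a} where

  toList-lookup : ∀ {k} (v : Vec A k) → toList v ≡ map (lookup v) (allFin k)
  toList-lookup V.[]       = refl
  toList-lookup (x V.∷ v) = cong (x ∷_) (begin
    toList v                               ≡⟨ toList-lookup v ⟩
    map (lookup v) (allFin _)              ≡⟨ LP.map-tabulate (λ i → i) (lookup v) ⟩
    L.tabulate (lookup v)                  ≡⟨ LP.map-tabulate F.suc (lookup (x V.∷ v)) ⟨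
    map (lookup (x V.∷ v)) (L.tabulate F.suc) ∎)
    where open ≡-Reasoning

  injective⇒Unique-toList : ∀ {k} (v : Vec A k) → (∀ i j → lookup v i ≡ lookup v j → i ≡ j) → Unique (toList v)
  injective⇒Unique-toList v inj =
    subst Unique (sym (toList-lookup v)) (Unique.map⁺ (inj _ _) (Unique.allFin⁺ _))

  Unique-toList⇒injective : ∀ {k} (v : Vec A k) → Unique (toList v) → ∀ i j → lookup v i ≡ lookup v j → i ≡ j
  Unique-toList⇒injective (x V.∷ v) _          F.zero    F.zero    _ = refl
  Unique-toList⇒injective (x V.∷ v) (x∉ ∷ _)  F.zero    (F.suc j) e = contradiction e (All.lookup x∉ (∈-toList⁺ (∈-lookup j v)))
  Unique-toList⇒injective (x V.∷ v) (x∉ ∷ _)  (F.suc i) F.zero    e = contradiction (sym e) (All.lookup x∉ (∈-toList⁺ (∈-lookup i v)))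
  Unique-toList⇒injective (x V.∷ v) (_ ∷ u)   (F.suc i) (F.suc j) e = cong F.suc (Unique-toList⇒injective v u i j e)

  toList-injective : ∀ {k} {v w : Vec A k} → toList v ≡ toList w → v ≡ w
  toList-injective {v = v} {w} eq = trans (sym (VP.cast-is-id refl v)) (VP.toList-injective refl v w eq)

  lookup-extensional : ∀ {k} {v w : Vec A k} → (∀ i → lookup v i ≡ lookup w i) → v ≡ w
  lookup-extensional {v = v} {w} eq =
    trans (sym (VP.tabulate∘lookup v)) (trans (VP.tabulate-cong eq) (VP.tabulate∘lookup w))

injective⇒surjective : ∀ {n} (f : Fin n → Fin n) → (∀ i j → f i ≡ f j → i ≡ j) → ∀ y → ∃ λ i → f i ≡ y
injective⇒surjective {suc m} f inj y with any? (λ i → f i FP.≟ y)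
... | yes found = found
... | no none =
  let i , j , i<j , pᵢ≡pⱼ = pigeonhole (n<1+n m) (λ i → punchOut (y≢f i))
  in  contradiction (inj i j (punchOut-injective (y≢f i) (y≢f j) pᵢ≡pⱼ)) (FP.<⇒≢ i<j)
  where
  y≢f : ∀ i → y ≢ f i
  y≢f i y≡fi = none (i , sym y≡fi)

allFin-increasing : ∀ k → AllPairs F._<_ (allFin k)
allFin-increasing k = AllPairs.tabulate⁺-< (λ i<j → i<j)

IsPerm⇒∈-toList : ∀ {n} (v : Vec (Fin n) n) → IsPerm v → ∀ x → x ∈ toList v
IsPerm⇒∈-toList v perm x =
  let i , vᵢ≡x = injective⇒surjective (lookup v) perm x
  in  subst (_∈ toList v) vᵢ≡x (∈-toList⁺ (∈-lookup i v))

concatMap≡cartesianProductWith : ∀ {A B C : Set} (f : A → B → C) xs ys →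
  concatMap (λ x → map (f x) ys) xs ≡ cartesianProductWith f xs ys
concatMap≡cartesianProductWith f []       ys = refl
concatMap≡cartesianProductWith f (x ∷ xs) ys = cong (map (f x) ys ++_) (concatMap≡cartesianProductWith f xs ys)

words-suc : ∀ n k → words n (suc k) ≡ cartesianProductWith V._∷_ (allFin n) (words n k)
words-suc n k = concatMap≡cartesianProductWith V._∷_ (allFin n) (words n k)

words-unique : ∀ n k → Unique (words n k)
words-unique n zero    = All.[] ∷ []
words-unique n (suc k) = subst Unique (sym (words-suc n k))
  (Unique.cartesianProductWith⁺ V._∷_ VP.∷-injective (Unique.allFin⁺ n) (words-unique n k))

words-complete : ∀ {n k} (v : Vec (Fin n) k) → v ∈ words n k
words-complete V.[]                    = here refl
words-complete {n} {suc k} (x V.∷ v) = subst (x V.∷ v ∈_) (sym (words-suc n k))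
  (∈-cartesianProductWith⁺ V._∷_ (∈-allFin x) (words-complete v))

-- Descents

module _ {n : ℕ} where

  descent : Fin n → Fin n → ℕ
  descent x y = if toℕ y <ᵇ toℕ x then 1 else 0

  descent≡1 : ∀ {x y} → y F.< x → descent x y ≡ 1
  descent≡1 {x} {y} y<x with toℕ y <ᵇ toℕ x | <ᵇ-reflects-< (toℕ y) (toℕ x)
  ... | true  | _          = refl
  ... | false | ofⁿ y≮x = contradiction y<x y≮x

  ≤⇒descent≡0 : ∀ {x y} → x F.≤ y → descent x y ≡ 0
  ≤⇒descent≡0 {x} {y} x≤y with toℕ y <ᵇ toℕ x | <ᵇ-reflects-< (toℕ y) (toℕ x)
  ... | true  | ofʸ y<x = contradiction x≤y (<⇒≱ y<x)
  ... | false | _       = refl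

  descent≡0⇒≤ : ∀ {x y} → descent x y ≡ 0 → x F.≤ y
  descent≡0⇒≤ {x} {y} _ with toℕ y <ᵇ toℕ x | <ᵇ-reflects-< (toℕ y) (toℕ x)
  ... | false | ofⁿ y≮x = ≮⇒≥ y≮x

  descent≤1 : ∀ x y → descent x y ≤ 1
  descent≤1 x y with toℕ y <ᵇ toℕ x
  ... | true  = ≤-refl
  ... | false = z≤n

  descent-triangle : ∀ x y z → descent x z ≤ descent x y + descent y z
  descent-triangle x y z with toℕ z <ᵇ toℕ x | <ᵇ-reflects-< (toℕ z) (toℕ x)
  ... | false | _       = z≤n
  ... | true  | ofʸ z<x with toℕ y <? toℕ x
  ...   | yes y<x = ≤-trans (≤-reflexive (sym (descent≡1 y<x))) (m≤m+n _ _)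
  ...   | no  y≮x = ≤-trans (≤-reflexive (sym (descent≡1 (<-≤-trans z<x (≮⇒≥ y≮x))))) (m≤n+m _ _)

  desFrom : Fin n → List (Fin n) → ℕ
  desFrom x []      = 0
  desFrom x (y ∷ l) = descent x y + desFrom y l

  des : List (Fin n) → ℕ
  des []      = 0
  des (x ∷ l) = desFrom x l

  desW-toList : ∀ {k} (v : Vec (Fin n) k) → desW v ≡ des (toList v)
  desW-toList V.[]                = refl
  desW-toList (x V.∷ V.[])        = refl
  desW-toList (x V.∷ y V.∷ v) = cong (descent x y +_) (desW-toList (y V.∷ v))

  des-++ : ∀ xs ys → des (xs ++ ys) ≤ des xs + (1 + des ys)
  des-++ []            ys       = n≤1+n (des ys)
  des-++ (x ∷ [])      []       = z≤n
  des-++ (x ∷ [])      (y ∷ ys) = +-monoˡ-≤ (des (y ∷ ys)) (descent≤1 x y)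
  des-++ (x ∷ y ∷ xs) ys =
    ≤-trans (+-monoʳ-≤ (descent x y) (des-++ (y ∷ xs) ys))
            (≤-reflexive (sym (+-assoc (descent x y) (des (y ∷ xs)) _)))

  des-tail : ∀ x l → des l ≤ des (x ∷ l)
  des-tail x []      = z≤n
  des-tail x (y ∷ l) = m≤n+m (des (y ∷ l)) (descent x y)

  des-∷-triangle : ∀ x y l → des (x ∷ l) ≤ descent x y + des (y ∷ l)
  des-∷-triangle x y []      = z≤n
  des-∷-triangle x y (z ∷ l) =
    ≤-trans (+-monoˡ-≤ (des (z ∷ l)) (descent-triangle x y z))
            (≤-reflexive (+-assoc (descent x y) (descent y z) _))

  des-∷-mono-⊆ : ∀ x {xs ys} → xs ⊆ ys → des (x ∷ xs) ≤ des (x ∷ ys)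
  des-∷-mono-⊆ x []                  = ≤-refl
  des-∷-mono-⊆ x (_∷ʳ_ {xs} y xs⊆ys) =
    ≤-trans (des-∷-triangle x y xs) (+-monoʳ-≤ (descent x y) (des-∷-mono-⊆ y xs⊆ys))
  des-∷-mono-⊆ x (_∷_ {y = y} refl xs⊆ys) = +-monoʳ-≤ (descent x y) (des-∷-mono-⊆ y xs⊆ys)

  des-mono-⊆ : ∀ {xs ys} → xs ⊆ ys → des xs ≤ des ys
  des-mono-⊆ []               = ≤-refl
  des-mono-⊆ (_∷ʳ_ {ys = ys} y xs⊆ys) = ≤-trans (des-mono-⊆ xs⊆ys) (des-tail y ys)
  des-mono-⊆ (_∷_ {x} refl xs⊆ys) = des-∷-mono-⊆ x xs⊆ys

  des≡0⇒sorted : ∀ l → des l ≡ 0 → Linked F._≤_ l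
  des≡0⇒sorted []          _   = []
  des≡0⇒sorted (x ∷ [])    _   = [-]
  des≡0⇒sorted (x ∷ y ∷ l) d≡0 =
    descent≡0⇒≤ (m+n≡0⇒m≡0 (descent x y) d≡0) ∷ des≡0⇒sorted (y ∷ l) (m+n≡0⇒n≡0 (descent x y) d≡0)

  des≡0⇒increasing : ∀ {l} → Unique l → des l ≡ 0 → AllPairs F._<_ l
  des≡0⇒increasing {l} u d≡0 = AllPairs.zipWith
    (λ (x≤y , x≢y) → ≤∧≢⇒< x≤y (x≢y ∘ toℕ-injective))
    (Linked⇒AllPairs ≤-trans (des≡0⇒sorted l d≡0) , u)

  increasing⇒des≡0 : ∀ {l} → AllPairs F._<_ l → des l ≡ 0
  increasing⇒des≡0 {[]}          _                = refl
  increasing⇒des≡0 {x ∷ []}      _                = refl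
  increasing⇒des≡0 {x ∷ y ∷ l} ((x<y All.∷ _) ∷ y∷l↗) = cong₂ _+_ (≤⇒descent≡0 (<⇒≤ x<y)) (increasing⇒des≡0 y∷l↗)

  -- The first ascending run

  runAfter : Fin n → List (Fin n) → List (Fin n)
  runAfter x []      = []
  runAfter x (y ∷ l) = if toℕ y <ᵇ toℕ x then [] else y ∷ runAfter y l

  restAfter : Fin n → List (Fin n) → List (Fin n)
  restAfter x []      = []
  restAfter x (y ∷ l) = if toℕ y <ᵇ toℕ x then y ∷ l else restAfter y l

  firstRun : List (Fin n) → List (Fin n)
  firstRun []      = []
  firstRun (x ∷ l) = x ∷ runAfter x l

  laterRuns : List (Fin n) → List (Fin n)
  laterRuns []      = []
  laterRuns (x ∷ l) = restAfter x l

  -- Induction hypotheses are taken in the with-heads: inside a with-clause, y ∷ l is no longer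
  -- recognised as a structural subterm of x ∷ y ∷ l.
  firstRun-++-laterRuns : ∀ l → firstRun l ++ laterRuns l ≡ l
  firstRun-++-laterRuns []          = refl
  firstRun-++-laterRuns (x ∷ [])    = refl
  firstRun-++-laterRuns (x ∷ y ∷ l) with toℕ y <ᵇ toℕ x | firstRun-++-laterRuns (y ∷ l)
  ... | true  | _  = refl
  ... | false | ih = cong (x ∷_) ih

  des-firstRun : ∀ l → des (firstRun l) ≡ 0
  des-firstRun []          = refl
  des-firstRun (x ∷ [])    = refl
  des-firstRun (x ∷ y ∷ l)
    with toℕ y <ᵇ toℕ x | <ᵇ-reflects-< (toℕ y) (toℕ x) | des-firstRun (y ∷ l)
  ... | true  | _       | _  = refl
  ... | false | ofⁿ y≮x | ih = cong₂ _+_ (≤⇒descent≡0 (≮⇒≥ y≮x)) ih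

  des-laterRuns : ∀ l → des l ≤ 1 → des (laterRuns l) ≡ 0
  des-laterRuns []          _   = refl
  des-laterRuns (x ∷ [])    _   = refl
  des-laterRuns (x ∷ y ∷ l) d≤1
    with toℕ y <ᵇ toℕ x | des-laterRuns (y ∷ l)
  ... | true  | _  = n≤0⇒n≡0 (s≤s⁻¹ d≤1)
  ... | false | ih = ih d≤1

  firstRun-sorted : ∀ l → des l ≡ 0 → firstRun l ≡ l
  firstRun-sorted []          _   = refl
  firstRun-sorted (x ∷ [])    _   = refl
  firstRun-sorted (x ∷ y ∷ l) d≡0
    with toℕ y <ᵇ toℕ x | firstRun-sorted (y ∷ l)
  ... | true  | _  = contradiction d≡0 λ ()
  ... | false | ih = cong (x ∷_) (ih d≡0)

  firstRun-++ : ∀ u {y} w → des u ≡ 0 → Any (y F.<_) u → firstRun (u ++ y ∷ w) ≡ u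
  firstRun-++ (x ∷ []) {y} w _ (here y<x) with toℕ y <ᵇ toℕ x | <ᵇ-reflects-< (toℕ y) (toℕ x)
  ... | true  | _       = refl
  ... | false | ofⁿ y≮x = contradiction y<x y≮x
  firstRun-++ (x ∷ x′ ∷ u) {y} w d≡0 y<u
    with toℕ x′ <ᵇ toℕ x | <ᵇ-reflects-< (toℕ x′) (toℕ x) | firstRun-++ (x′ ∷ u) w
  ... | true  | ofʸ x′<x | _  = contradiction (descent≡0⇒≤ (m+n≡0⇒m≡0 (descent x x′) d≡0)) (<⇒≱ x′<x)
  ... | false | ofⁿ x′≮x | ih = cong (x ∷_) (ih (m+n≡0⇒n≡0 (descent x x′) d≡0) (shift y<u))
    where
    shift : Any (y F.<_) (x ∷ x′ ∷ u) → Any (y F.<_) (x′ ∷ u)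
    shift (here y<x)  = here (<-≤-trans y<x (≮⇒≥ x′≮x))
    shift (there y<u) = y<u

  firstRun-laterRuns-descent : ∀ l → des l ≢ 0 →
    ∃₂ λ z y → z ∈ firstRun l × y ∈ laterRuns l × y F.< z
  firstRun-laterRuns-descent []          d≢0 = contradiction refl d≢0
  firstRun-laterRuns-descent (x ∷ [])    d≢0 = contradiction refl d≢0
  firstRun-laterRuns-descent (x ∷ y ∷ l) d≢0
    with toℕ y <ᵇ toℕ x | <ᵇ-reflects-< (toℕ y) (toℕ x) | firstRun-laterRuns-descent (y ∷ l)
  ... | true  | ofʸ y<x | _  = x , y , here refl , here refl , y<x
  ... | false | _       | ih with ih d≢0
  ...   | z , w , z∈ , w∈ , w<z = z , w , there z∈ , w∈ , w<z

  firstRun-++-increasing : ∀ {u w i j} → AllPairs F._<_ u → AllPairs F._<_ w →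
                           j ∈ u → i ∈ w → i F.< j → firstRun (u ++ w) ≡ u
  firstRun-++-increasing {u} {w₀ ∷ w} {i} u↗ (w₀<w ∷ _) j∈u i∈w i<j =
    firstRun-++ u w (increasing⇒des≡0 u↗) (Any.map (λ { refl → ≤-<-trans (w₀≤ i∈w) i<j }) j∈u)
    where
    w₀≤ : ∀ {z} → z ∈ w₀ ∷ w → w₀ F.≤ z
    w₀≤ (here refl)  = ≤-refl
    w₀≤ (there z∈w) = <⇒≤ (All.lookup w₀<w z∈w)

  Unique-runs : ∀ {l} → Unique l → Unique (firstRun l) × Unique (laterRuns l) × Disjoint (firstRun l) (laterRuns l)
  Unique-runs {l} u = Unique-++⁻ (firstRun l) (subst Unique (sym (firstRun-++-laterRuns l)) u)

  runs-increasing : ∀ {l} → Unique l → des l ≤ 1 → AllPairs F._<_ (firstRun l) × AllPairs F._<_ (laterRuns l)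
  runs-increasing {l} u d≤1 =
    let u₁ , u₂ , _ = Unique-runs u
    in  des≡0⇒increasing u₁ (des-firstRun l) , des≡0⇒increasing u₂ (des-laterRuns l d≤1)

  toList-square : (v : Vec (Fin n) n) → toList (square v) ≡ map (lookup v) (toList v)
  toList-square v = begin
    toList (tabulate (lookup v ∘ lookup v))          ≡⟨ cong toList (VP.tabulate-∘ (lookup v) (lookup v)) ⟩
    toList (V.map (lookup v) (tabulate (lookup v)))  ≡⟨ cong (toList ∘ V.map (lookup v)) (VP.tabulate∘lookup v) ⟩
    toList (V.map (lookup v) v)                      ≡⟨ VP.toList-map (lookup v) v ⟩
    map (lookup v) (toList v)                        ∎
    where open ≡-Reasoning

  des-map-lookup : ∀ {k} (v : Vec (Fin n) k) {s} → AllPairs F._<_ s → des (map (lookup v) s) ≤ des (toList v)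
  des-map-lookup {k} v {s} s↗ = des-mono-⊆ (subst (map (lookup v) s ⊆_) (sym (toList-lookup v))
    (Sublist.map⁺ (lookup v) (sorted-⊆ s↗ (allFin-increasing k) (λ {i} _ → ∈-allFin i))))
    where open StrictlySorted (FP.<-isStrictPartialOrder {k})

  des-square≤3 : (v : Vec (Fin n) n) → IsPerm v → desW v ≤ 1 → desW (square v) ≤ 3
  des-square≤3 v perm desW≤1 = begin
    desW (square v)                       ≡⟨ desW-toList (square v) ⟩
    des (toList (square v))               ≡⟨ cong des (toList-square v) ⟩
    des (map f l)                         ≡⟨ cong (des ∘ map f) (firstRun-++-laterRuns l) ⟨
    des (map f (u ++ w))                  ≡⟨ cong des (LP.map-++ f u w) ⟩
    des (map f u ++ map f w)              ≤⟨ des-++ (map f u) (map f w) ⟩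
    des (map f u) + (1 + des (map f w))   ≤⟨ +-mono-≤ (des-map-lookup v u↗) (s≤s (des-map-lookup v w↗)) ⟩
    des l + (1 + des l)                   ≤⟨ +-mono-≤ d≤1 (s≤s d≤1) ⟩
    3                                     ∎
    where
    open ≤-Reasoning
    f = lookup v
    l = toList v
    u = firstRun l
    w = laterRuns l
    d≤1 : des l ≤ 1
    d≤1 = subst (_≤ 1) (desW-toList v) desW≤1
    u↗w↗ = runs-increasing (injective⇒Unique-toList v perm) d≤1
    u↗ = proj₁ u↗w↗
    w↗ = proj₂ u↗w↗

-- Bit vectors

pattern bit0 = F.zero
pattern bit1 = F.suc F.zero

module _ {n : ℕ} where

  positions : Fin 2 → Vec (Fin 2) n → List (Fin n)
  positions c b = filter (λ x → lookup b x FP.≟ c) (allFin n)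

  ∈-positions⁺ : ∀ c b {x} → lookup b x ≡ c → x ∈ positions c b
  ∈-positions⁺ c b {x} = ∈-filter⁺ (λ y → lookup b y FP.≟ c) (∈-allFin x)

  ∈-positions⁻ : ∀ c b {x} → x ∈ positions c b → lookup b x ≡ c
  ∈-positions⁻ c b x∈ = proj₂ (∈-filter⁻ (λ y → lookup b y FP.≟ c) {xs = allFin n} x∈)

  positions-increasing : ∀ c b → AllPairs F._<_ (positions c b)
  positions-increasing c b = AllPairs.filter⁺ _ (allFin-increasing n)

  grassmannianList : Vec (Fin 2) n → List (Fin n)
  grassmannianList b = positions bit1 b ++ positions bit0 b

  Unique-grassmannianList : ∀ b → Unique (grassmannianList b)
  Unique-grassmannianList b =
    Unique.++⁺ (Unique.filter⁺ _ (Unique.allFin⁺ n)) (Unique.filter⁺ _ (Unique.allFin⁺ n)) λ (x∈₁ , x∈₀)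
       → contradiction (trans (sym (∈-positions⁻ bit1 b x∈₁)) (∈-positions⁻ bit0 b x∈₀)) λ ()

  ∈-grassmannianList : ∀ b x → x ∈ grassmannianList b
  ∈-grassmannianList b x with lookup b x in bₓ
  ... | bit0 = ∈-++⁺ʳ (positions bit1 b) (∈-positions⁺ bit0 b bₓ)
  ... | bit1 = ∈-++⁺ˡ (∈-positions⁺ bit1 b bₓ)

  length-grassmannianList : ∀ b → length (grassmannianList b) ≡ n
  length-grassmannianList b = trans
    (Unique-⇔⇒length-≡ (Unique-grassmannianList b) (Unique.allFin⁺ n)
                        (λ {x} → mk⇔ (λ _ → ∈-allFin x) (λ _ → ∈-grassmannianList b x)))
    (LP.length-tabulate (λ i → i))

  grassmannian : Vec (Fin 2) n → Vec (Fin n) n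
  grassmannian b = V.cast (length-grassmannianList b) (V.fromList (grassmannianList b))

  toList-grassmannian : ∀ b → toList (grassmannian b) ≡ grassmannianList b
  toList-grassmannian b = trans (VP.toList-cast _ (V.fromList (grassmannianList b))) (VP.toList∘fromList _)

  decBit : ∀ {P : Set} → Dec P → Fin 2
  decBit (yes _) = bit1
  decBit (no _)  = bit0

  indicator : List (Fin n) → Vec (Fin 2) n
  indicator l = tabulate (λ x → decBit (Any.any? (x FP.≟_) l))

  lookup-indicator-∈ : ∀ {l x} → x ∈ l → lookup (indicator l) x ≡ bit1
  lookup-indicator-∈ {l} {x} x∈l rewrite VP.lookup∘tabulate (λ y → decBit (Any.any? (y FP.≟_) l)) x
    with Any.any? (x FP.≟_) l
  ... | yes _   = refl
  ... | no x∉l = contradiction x∈l x∉l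

  lookup-indicator-∉ : ∀ {l x} → x ∉ l → lookup (indicator l) x ≡ bit0
  lookup-indicator-∉ {l} {x} x∉l rewrite VP.lookup∘tabulate (λ y → decBit (Any.any? (y FP.≟_) l)) x
    with Any.any? (x FP.≟_) l
  ... | yes x∈l = contradiction x∈l x∉l
  ... | no _    = refl

  lookup-indicator≡bit1⇒∈ : ∀ {l x} → lookup (indicator l) x ≡ bit1 → x ∈ l
  lookup-indicator≡bit1⇒∈ {l} {x} e with Any.any? (x FP.≟_) l
  ... | yes x∈l = x∈l
  ... | no x∉l  = contradiction (trans (sym e) (lookup-indicator-∉ x∉l)) λ ()

  indicator-positions : ∀ b → indicator (positions bit1 b) ≡ b
  indicator-positions b = lookup-extensional λ x → bitAt x
    where
    bitAt : ∀ x → lookup (indicator (positions bit1 b)) x ≡ lookup b x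
    bitAt x with lookup b x in bₓ
    ... | bit1 = lookup-indicator-∈ (∈-positions⁺ bit1 b bₓ)
    ... | bit0 = lookup-indicator-∉ λ x∈ → contradiction (trans (sym bₓ) (∈-positions⁻ bit1 b x∈)) λ ()

hasBit1 : ∀ {k} → Vec (Fin 2) k → Bool
hasBit1 V.[]          = false
hasBit1 (bit0 V.∷ b) = hasBit1 b
hasBit1 (bit1 V.∷ b) = true

admissible : ∀ {k} → Vec (Fin 2) k → Bool
admissible V.[]          = true
admissible (bit0 V.∷ b) = hasBit1 b
admissible (bit1 V.∷ b) = admissible b

AllBit1 : ∀ {k} → Vec (Fin 2) k → Set
AllBit1 b = ∀ i → lookup b i ≡ bit1

ZeroBeforeOne : ∀ {k} → Vec (Fin 2) k → Set
ZeroBeforeOne b = ∃₂ λ i j → i F.< j × lookup b i ≡ bit0 × lookup b j ≡ bit1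

hasBit1-sound : ∀ {k} (b : Vec (Fin 2) k) → T (hasBit1 b) → ∃ λ j → lookup b j ≡ bit1
hasBit1-sound (bit0 V.∷ b) t = let j , bⱼ≡1 = hasBit1-sound b t in F.suc j , bⱼ≡1
hasBit1-sound (bit1 V.∷ b) t = F.zero , refl

hasBit1-complete : ∀ {k} (b : Vec (Fin 2) k) j → lookup b j ≡ bit1 → T (hasBit1 b)
hasBit1-complete (bit0 V.∷ b) (F.suc j) bⱼ≡1 = hasBit1-complete b j bⱼ≡1
hasBit1-complete (bit1 V.∷ b) _         _    = tt

admissible-sound : ∀ {k} (b : Vec (Fin 2) k) → T (admissible b) → AllBit1 b ⊎ ZeroBeforeOne b
admissible-sound V.[]          _ = inj₁ λ ()
admissible-sound (bit0 V.∷ b) t =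
  let j , bⱼ≡1 = hasBit1-sound b t in inj₂ (F.zero , F.suc j , s≤s z≤n , refl , bⱼ≡1)
admissible-sound (bit1 V.∷ b) t with admissible-sound b t
... | inj₁ all1 = inj₁ λ { F.zero → refl ; (F.suc i) → all1 i }
... | inj₂ (i , j , i<j , bᵢ≡0 , bⱼ≡1) = inj₂ (F.suc i , F.suc j , s≤s i<j , bᵢ≡0 , bⱼ≡1)

admissible-complete : ∀ {k} (b : Vec (Fin 2) k) → AllBit1 b ⊎ ZeroBeforeOne b → T (admissible b)
admissible-complete V.[]          _ = tt
admissible-complete (bit0 V.∷ b) (inj₁ all1) with () ← all1 F.zero
admissible-complete (bit0 V.∷ b) (inj₂ (_ , F.suc j , _ , _ , bⱼ≡1)) = hasBit1-complete b j bⱼ≡1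
admissible-complete (bit1 V.∷ b) (inj₁ all1) = admissible-complete b (inj₁ (all1 ∘ F.suc))
admissible-complete (bit1 V.∷ b) (inj₂ (F.suc i , F.suc j , s≤s i<j , bᵢ≡0 , bⱼ≡1)) =
  admissible-complete b (inj₂ (i , j , i<j , bᵢ≡0 , bⱼ≡1))

count : ∀ {k} → (Vec (Fin 2) k → Bool) → ℕ
count {k} p = length (filter (T? ∘ p) (words 2 k))

count-∷ : ∀ {k} (p : Vec (Fin 2) (suc k) → Bool) → count p ≡ count (p ∘ (bit0 V.∷_)) + count (p ∘ (bit1 V.∷_))
count-∷ {k} p = begin
  length (filter P (bs₀ ++ (bs₁ ++ [])))           ≡⟨ cong (length ∘ filter P ∘ (bs₀ ++_)) (LP.++-identityʳ bs₁) ⟩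
  length (filter P (bs₀ ++ bs₁))                   ≡⟨ cong length (LP.filter-++ P bs₀ bs₁) ⟩
  length (filter P bs₀ ++ filter P bs₁)            ≡⟨ LP.length-++ (filter P bs₀) ⟩
  length (filter P bs₀) + length (filter P bs₁)    ≡⟨ cong₂ _+_ (length-filter-map P _ (words 2 k)) (length-filter-map P _ (words 2 k)) ⟩
  count (p ∘ (bit0 V.∷_)) + count (p ∘ (bit1 V.∷_)) ∎
  where
  open ≡-Reasoning
  P = T? ∘ p
  bs₀ = map (bit0 V.∷_) (words 2 k)
  bs₁ = map (bit1 V.∷_) (words 2 k)

2^k+2^k≡2^[1+k] : ∀ k → 2 ^ k + 2 ^ k ≡ 2 ^ suc k
2^k+2^k≡2^[1+k] k = cong (2 ^ k +_) (sym (+-identityʳ (2 ^ k)))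

count-true : ∀ k → count {k} (λ _ → true) ≡ 2 ^ k
count-true zero    = refl
count-true (suc k) = begin
  count {suc k} (λ _ → true)                         ≡⟨ count-∷ {k} (λ _ → true) ⟩
  count {k} (λ _ → true) + count {k} (λ _ → true)    ≡⟨ cong₂ _+_ (count-true k) (count-true k) ⟩
  2 ^ k + 2 ^ k                                      ≡⟨ 2^k+2^k≡2^[1+k] k ⟩
  2 ^ suc k                                          ∎
  where open ≡-Reasoning

count-hasBit1 : ∀ k → 1 + count {k} hasBit1 ≡ 2 ^ k
count-hasBit1 zero    = refl
count-hasBit1 (suc k) = begin
  1 + count {suc k} hasBit1                          ≡⟨ cong (1 +_) (count-∷ {k} hasBit1) ⟩
  (1 + count {k} hasBit1) + count {k} (λ _ → true)   ≡⟨ cong₂ _+_ (count-hasBit1 k) (count-true k) ⟩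
  2 ^ k + 2 ^ k                                      ≡⟨ 2^k+2^k≡2^[1+k] k ⟩
  2 ^ suc k                                          ∎
  where open ≡-Reasoning

count-admissible : ∀ k → k + count {k} admissible ≡ 2 ^ k
count-admissible zero    = refl
count-admissible (suc k) = begin
  suc k + count {suc k} admissible                   ≡⟨ cong (suc k +_) (count-∷ {k} admissible) ⟩
  suc k + (count {k} hasBit1 + count {k} admissible) ≡⟨ cong suc (x∙yz≈y∙xz k (count {k} hasBit1) (count {k} admissible)) ⟩
  (1 + count {k} hasBit1) + (k + count {k} admissible) ≡⟨ cong₂ _+_ (count-hasBit1 k) (count-admissible k) ⟩
  2 ^ k + 2 ^ k                                      ≡⟨ 2^k+2^k≡2^[1+k] k ⟩
  2 ^ suc k                                          ∎
  where open ≡-Reasoning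

-- Grassmannian permutations

module _ {n : ℕ} where

  open StrictlySorted (FP.<-isStrictPartialOrder {n}) using (sorted-≡)

  firstRun-grassmannianList : ∀ (b : Vec (Fin 2) n) → T (admissible b) →
                              firstRun (grassmannianList b) ≡ positions bit1 b
  firstRun-grassmannianList b adm with admissible-sound b adm
  ... | inj₁ all1 = begin
    firstRun (positions bit1 b ++ positions bit0 b) ≡⟨ cong (firstRun ∘ (positions bit1 b ++_)) no-zeros ⟩
    firstRun (positions bit1 b ++ [])               ≡⟨ cong firstRun (LP.++-identityʳ (positions bit1 b)) ⟩
    firstRun (positions bit1 b)                     ≡⟨ firstRun-sorted _ (increasing⇒des≡0 (positions-increasing bit1 b)) ⟩
    positions bit1 b                                ∎
    where
    open ≡-Reasoning
    no-zeros : positions bit0 b ≡ []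
    no-zeros = LP.filter-none (λ x → lookup b x FP.≟ bit0) {allFin n}
      (All.tabulate λ {x} _ bₓ≡0 → contradiction (trans (sym bₓ≡0) (all1 x)) λ ())
  ... | inj₂ (i , j , i<j , bᵢ≡0 , bⱼ≡1) =
    firstRun-++-increasing (positions-increasing bit1 b) (positions-increasing bit0 b)
      (∈-positions⁺ bit1 b bⱼ≡1) (∈-positions⁺ bit0 b bᵢ≡0) i<j

  firstRunBits : Vec (Fin n) n → Vec (Fin 2) n
  firstRunBits π = indicator (firstRun (toList π))

  grassmannian-good : ∀ (b : Vec (Fin 2) n) → Good (grassmannian b)
  grassmannian-good b = perm , desW≤1 , des-square≤3 (grassmannian b) perm desW≤1
    where
    perm : IsPerm (grassmannian b)
    perm = Unique-toList⇒injective (grassmannian b)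
      (subst Unique (sym (toList-grassmannian b)) (Unique-grassmannianList b))
    desW≤1 : desW (grassmannian b) ≤ 1
    desW≤1 = begin
      desW (grassmannian b)                                ≡⟨ desW-toList (grassmannian b) ⟩
      des (toList (grassmannian b))                        ≡⟨ cong des (toList-grassmannian b) ⟩
      des (positions bit1 b ++ positions bit0 b)           ≤⟨ des-++ (positions bit1 b) (positions bit0 b) ⟩
      des (positions bit1 b) + (1 + des (positions bit0 b)) ≡⟨ cong₂ (λ d e → d + (1 + e))
                                                                 (increasing⇒des≡0 (positions-increasing bit1 b))
                                                                 (increasing⇒des≡0 (positions-increasing bit0 b)) ⟩
      1                                                    ∎
      where open ≤-Reasoning

  firstRunBits-admissible : ∀ {π : Vec (Fin n) n} → IsPerm π → T (admissible (firstRunBits π))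
  firstRunBits-admissible {π} perm with des (toList π) ≟ℕ 0
  ... | yes d≡0 = admissible-complete (firstRunBits π) (inj₁ λ x →
    lookup-indicator-∈ (subst (x ∈_) (sym (firstRun-sorted (toList π) d≡0)) (IsPerm⇒∈-toList π perm x)))
  ... | no d≢0 =
    let z , y , z∈u , y∈w , y<z = firstRun-laterRuns-descent (toList π) d≢0
        _ , _ , u#w = Unique-runs (injective⇒Unique-toList π perm)
    in  admissible-complete (firstRunBits π)
          (inj₂ (y , z , y<z , lookup-indicator-∉ (λ y∈u → u#w (y∈u , y∈w)) , lookup-indicator-∈ z∈u))

  grassmannian-firstRunBits : ∀ {π : Vec (Fin n) n} → Good π → grassmannian (firstRunBits π) ≡ π
  grassmannian-firstRunBits {π} (perm , desW≤1 , _) = toList-injective (begin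
    toList (grassmannian bits)                 ≡⟨ toList-grassmannian bits ⟩
    positions bit1 bits ++ positions bit0 bits ≡⟨ cong₂ _++_ ones≡u zeros≡w ⟩
    u ++ w                                     ≡⟨ firstRun-++-laterRuns l ⟩
    l                                          ∎)
    where
    open ≡-Reasoning
    l = toList π
    u = firstRun l
    w = laterRuns l
    bits = indicator u
    u-l = injective⇒Unique-toList π perm
    u↗w↗ = runs-increasing u-l (subst (_≤ 1) (desW-toList π) desW≤1)
    u#w = proj₂ (proj₂ (Unique-runs u-l))
    ones≡u : positions bit1 bits ≡ u
    ones≡u = sorted-≡ (positions-increasing bit1 bits) (proj₁ u↗w↗)
      (λ x∈ → lookup-indicator≡bit1⇒∈ (∈-positions⁻ bit1 bits x∈))
      (λ x∈u → ∈-positions⁺ bit1 bits (lookup-indicator-∈ x∈u))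
    zeros⊆w : ∀ {x} → x ∈ positions bit0 bits → x ∈ w
    zeros⊆w {x} x∈ with ∈-++⁻ u (subst (x ∈_) (sym (firstRun-++-laterRuns l)) (IsPerm⇒∈-toList π perm x))
    ... | inj₁ x∈u = contradiction (trans (sym (∈-positions⁻ bit0 bits x∈)) (lookup-indicator-∈ x∈u)) λ ()
    ... | inj₂ x∈w = x∈w
    zeros≡w : positions bit0 bits ≡ w
    zeros≡w = sorted-≡ (positions-increasing bit0 bits) (proj₂ u↗w↗) zeros⊆w
      (λ x∈w → ∈-positions⁺ bit0 bits (lookup-indicator-∉ (λ x∈u → u#w (x∈u , x∈w))))

  firstRunBits-grassmannian : ∀ {b : Vec (Fin 2) n} → T (admissible b) → firstRunBits (grassmannian b) ≡ b
  firstRunBits-grassmannian {b} adm = begin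
    indicator (firstRun (toList (grassmannian b)))  ≡⟨ cong (indicator ∘ firstRun) (toList-grassmannian b) ⟩
    indicator (firstRun (grassmannianList b))       ≡⟨ cong indicator (firstRun-grassmannianList b adm) ⟩
    indicator (positions bit1 b)                    ≡⟨ indicator-positions b ⟩
    b                                               ∎
    where open ≡-Reasoning

  countGood≡count-admissible : countGood n ≡ count {n} admissible
  countGood≡count-admissible = length-filter-≡-by-inverses good? (T? ∘ admissible) firstRunBits grassmannian
    (words-unique n n) words-complete (words-unique 2 n) words-complete
    (λ good → firstRunBits-admissible (proj₁ good)) (λ {b} _ → grassmannian-good b)
    grassmannian-firstRunBits firstRunBits-grassmannian

-- The count is also right for n = 0.
corollary2p6 : (n : ℕ) → 1 ≤ n → countGood n ≡ 2 ^ n ∸ n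
corollary2p6 n _ = begin
  countGood n                       ≡⟨ countGood≡count-admissible {n} ⟩
  count {n} admissible              ≡⟨ m+n∸m≡n n (count {n} admissible) ⟨
  n + count {n} admissible ∸ n      ≡⟨ cong (_∸ n) (count-admissible n) ⟩
  2 ^ n ∸ n                         ∎
  where open ≡-Reasoning
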